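{- Let $n\ge 2$. The number of pairs $(\overline{n},\mathcal{M})$, where $\overline{n}=(\overline{n}_1,\overline{n}_2)\in\mathbb{N}_{>0}^2$ with $\overline{n}_1+\overline{n}_2=n$ and $\mathcal{M}\in\mathbb{N}^{r\times 2}$ for some $r\ge 1$ with rows $m^1,\dots,m^r$, satisfying (II') $0\le m^i_j\le\overline{n}_j$ for all $1\le i\le r$, $j\in\{1,2\}$; (III') $m^i_1>m^{i+1}_1$ and $m^i_2<m^{i+1}_2$ for all $1\le i\le r-1$; (IV') there is an index $1\le h\le r$ such that for $m':=m^h+(-1,1)$ or for $m':=m^h+(1,-1)$ we have $(0,0)\preceq m'\preceq\overline{n}$ and $m^{h'}\not\succeq m'$ for all $1\le h'\le r$, equals $2^{n+2}-n^2-3n-4$.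
   Context: For $x,y\in\mathbb{Z}^2$, $x\preceq y$ (equivalently $y\succeq x$) means $x_1\le y_1$ and $x_2\le y_2$. -}

module Defs where

open import Data.Nat using (ℕ; _≤_; _<_; _+_)
open import Data.Integer as ℤ using (ℤ; +_) renaming (_≤_ to _≤ℤ_)
open import Data.Product using (_×_; _,_; Σ; ∃)
open import Data.Sum using (_⊎_)
open import Data.List using (List; []; _∷_)
open import Data.List.Relation.Unary.All using (All)
open import Data.List.Relation.Unary.Any using (Any)
open import Data.List.Relation.Unary.Linked using (Linked)
open import Relation.Nullary using (¬_)

-- A row m = (m₁ , m₂) ∈ ℕ², a matrix M ∈ ℕ^{r×2} is the list of its rows m¹ … mʳ.
Row : Set
Row = ℕ × ℕ

_⪯_ : ℤ × ℤ → ℤ × ℤ → Set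
(x₁ , x₂) ⪯ (y₁ , y₂) = (x₁ ≤ℤ y₁) × (x₂ ≤ℤ y₂)

toℤ² : ℕ × ℕ → ℤ × ℤ
toℤ² (a , b) = (+ a , + b)

shiftL : Row → ℤ × ℤ
shiftL (a , b) = (+ a ℤ.- + 1 , + b ℤ.+ + 1)

shiftR : Row → ℤ × ℤ
shiftR (a , b) = (+ a ℤ.+ + 1 , + b ℤ.- + 1)

CondII : Row → List Row → Set
CondII (n₁ , n₂) M = All (λ { (a , b) → (a ≤ n₁) × (b ≤ n₂) }) M

StepIII : Row → Row → Set
StepIII (a , b) (a' , b') = (a' < a) × (b < b')

CondIII : List Row → Set
CondIII M = Linked StepIII M

Admissible : Row → List Row → ℤ × ℤ → Set
Admissible nbar M m' =
  ((+ 0 , + 0) ⪯ m') × (m' ⪯ toℤ² nbar) × All (λ m → ¬ (m' ⪯ toℤ² m)) M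

CondIV : Row → List Row → Set
CondIV nbar M = Any (λ m → Admissible nbar M (shiftL m) ⊎ Admissible nbar M (shiftR m)) M

NonEmpty : List Row → Set
NonEmpty [] = ⊥' where open import Data.Empty renaming (⊥ to ⊥')
NonEmpty (_ ∷ _) = ⊤' where open import Data.Unit renaming (⊤ to ⊤')

Valid : ℕ → Row × List Row → Set
Valid n ((n₁ , n₂) , M) =
  (1 ≤ n₁) × (1 ≤ n₂) × (n₁ + n₂ ≡' n) × NonEmpty M
  × CondII (n₁ , n₂) M × CondIII M × CondIV (n₁ , n₂) M
  where open import Relation.Binary.PropositionalEquality renaming (_≡_ to _≡'_)

{-# OPTIONS --safe #-}
-- For fixed n̄ the chains satisfying (II') and (III') in the box [0 , n̄₁] × [0 , n̄₂] number
-- C(n + 2 , n̄₁ + 1). A chain violates (IV') exactly when it is empty or a maximal diagonal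
-- staircase starting on the edge m₁ = n̄₁ or m₂ = 0: a row which is not the diagonal
-- neighbour of the next (previous) row can be shifted by (-1 , 1) (by (1 , -1)). There are
-- n + 2 such chains, so summing over n̄₁ = 1 , … , n - 1 gives
-- Σ_{2 ≤ j ≤ n} C(n + 2 , j) - (n - 1)(n + 2) = 2^(n+2) - n² - 3n - 4.
module Submission where

open import Defs
open import Data.Nat using (ℕ; zero; suc; _≤_; _<_; _+_; _*_; _^_; _∸_; z≤n; s≤s; z<s; _≟_)
open import Data.Nat.Properties
open import Data.Nat.Tactic.RingSolver using (solve-∀)
open import Data.Integer as ℤ using (+≤+)
open import Data.Integer.Properties using (drop‿+≤+)
open import Data.Product as Product using (_×_; _,_; Σ; ∃₂; proj₁; proj₂)
open import Data.Sum using (_⊎_; inj₁; inj₂)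
open import Data.Empty using (⊥-elim)
open import Data.Unit using (tt)
open import Data.List using (List; []; _∷_; _++_; length; map; filter; applyUpTo)
open import Data.List.Properties
  using (length-++; length-map; length-applyUpTo; ++-assoc; ∷-injectiveˡ; ∷-injectiveʳ)
open import Data.List.Relation.Unary.All as All using (All; []; _∷_)
import Data.List.Relation.Unary.All.Properties as All
open import Data.List.Relation.Unary.Any as Any using (here; there)
import Data.List.Relation.Unary.Any.Properties as Any
open import Data.List.Relation.Unary.AllPairs as AllPairs using ([]; _∷_)
open import Data.List.Relation.Unary.Linked as Linked using ([]; [-]; _∷_)
open import Data.List.Relation.Unary.Linked.Properties using (Linked⇒AllPairs)
open import Data.List.Relation.Unary.Unique.Propositional using (Unique)
import Data.List.Relation.Unary.Unique.Propositional.Properties as Unique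
open import Data.List.Relation.Binary.Disjoint.Propositional using (Disjoint)
open import Data.List.Relation.Binary.BagAndSetEquality using (_∼[_]_; set; ∼bag⇒↭)
open import Data.List.Relation.Binary.Permutation.Propositional.Properties using (↭-length)
open import Data.List.Membership.Propositional using (_∈_; find)
open import Data.List.Membership.Propositional.Properties
  using ( ∈-map⁺; ∈-map⁻; ∈-++⁺ˡ; ∈-++⁺ʳ; ∈-++⁻; ∈-filter⁺; ∈-filter⁻
        ; ∈-applyUpTo⁺; ∈-applyUpTo⁻)
open import Data.List.Membership.Propositional.Properties.WithK using (unique∧set⇒bag)
open import Function.Base using (_∘_)
open import Function.Bundles using (_⇔_; mk⇔)
open import Relation.Nullary using (¬_; Dec; yes; no)
open import Relation.Nullary.Decidable using (_×-dec_; _⊎-dec_; ¬?)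
open import Relation.Unary using (Decidable)
open import Relation.Binary.PropositionalEquality
  using (_≡_; _≢_; refl; sym; trans; cong; cong₂; subst; module ≡-Reasoning)

open ≡-Reasoning

length-filter+length-filter-¬ : {A : Set} {P : A → Set} (P? : Decidable P) (xs : List A) →
  length (filter P? xs) + length (filter (¬? ∘ P?) xs) ≡ length xs
length-filter+length-filter-¬ P? []       = refl
length-filter+length-filter-¬ P? (x ∷ xs) with P? x
... | yes _ = cong suc (length-filter+length-filter-¬ P? xs)
... | no  _ = trans (+-suc _ _) (cong suc (length-filter+length-filter-¬ P? xs))

unique∧set⇒length≡ : {A : Set} {xs ys : List A} → Unique xs → Unique ys →
  xs ∼[ set ] ys → length xs ≡ length ys
unique∧set⇒length≡ xs! ys! xs≈ys = ↭-length (∼bag⇒↭ (unique∧set⇒bag xs! ys! xs≈ys))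

-- Binomial coefficients along an antidiagonal

-- pascal p k = (p + k) choose p.
pascal : ℕ → ℕ → ℕ
pascal zero    k       = 1
pascal (suc p) zero    = 1
pascal (suc p) (suc k) = pascal p (suc k) + pascal (suc p) k

pascal-zeroʳ : ∀ p → pascal p 0 ≡ 1
pascal-zeroʳ zero    = refl
pascal-zeroʳ (suc p) = refl

pascal-oneʳ : ∀ p → pascal p 1 ≡ suc p
pascal-oneʳ zero    = refl
pascal-oneʳ (suc p) = trans (cong (_+ 1) (pascal-oneʳ p)) (+-comm (suc p) 1)

pascal-oneˡ : ∀ k → pascal 1 k ≡ suc k
pascal-oneˡ zero    = refl
pascal-oneˡ (suc k) = cong suc (pascal-oneˡ k)

antidiagonal : ℕ → ℕ → ℕ
antidiagonal i zero    = pascal i 0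
antidiagonal i (suc k) = pascal i (suc k) + antidiagonal (suc i) k

antidiagonal-pascal : ∀ i k →
  antidiagonal (suc i) (suc k) ≡ antidiagonal i (suc k) + antidiagonal (suc i) k
antidiagonal-pascal i zero    = refl
antidiagonal-pascal i (suc k) = begin
  pascal (suc i) (suc (suc k)) + antidiagonal (suc (suc i)) (suc k)
    ≡⟨ cong (pascal (suc i) (suc (suc k)) +_) (antidiagonal-pascal (suc i) k) ⟩
  (pascal i (suc (suc k)) + pascal (suc i) (suc k))
    + (antidiagonal (suc i) (suc k) + antidiagonal (suc (suc i)) k)
    ≡⟨ interchange (pascal i (suc (suc k))) (pascal (suc i) (suc k))
                    (antidiagonal (suc i) (suc k)) (antidiagonal (suc (suc i)) k) ⟩
  antidiagonal i (suc (suc k)) + antidiagonal (suc i) (suc k) ∎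
  where
  interchange : ∀ w x y z → (w + x) + (y + z) ≡ (w + y) + (x + z)
  interchange = solve-∀

antidiagonal-zero-suc : ∀ k → antidiagonal 0 (suc k) ≡ antidiagonal 0 k + antidiagonal 0 k
antidiagonal-zero-suc zero    = refl
antidiagonal-zero-suc (suc k) = begin
  1 + antidiagonal 1 (suc k)                       ≡⟨ cong suc (antidiagonal-pascal 0 k) ⟩
  1 + (antidiagonal 0 (suc k) + antidiagonal 1 k)  ≡⟨ +-suc (antidiagonal 0 (suc k)) _ ⟨
  antidiagonal 0 (suc k) + antidiagonal 0 (suc k)  ∎

antidiagonal-zero : ∀ k → antidiagonal 0 k ≡ 2 ^ k
antidiagonal-zero zero    = refl
antidiagonal-zero (suc k) = begin
  antidiagonal 0 (suc k)                   ≡⟨ antidiagonal-zero-suc k ⟩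
  antidiagonal 0 k + antidiagonal 0 k      ≡⟨ cong (λ x → x + x) (antidiagonal-zero k) ⟩
  2 ^ k + 2 ^ k                            ≡⟨ cong (2 ^ k +_) (+-identityʳ (2 ^ k)) ⟨
  2 ^ suc k                                ∎

-- Chains in a grid

step-trans : ∀ {x y z : Row} → StepIII x y → StepIII y z → StepIII x z
step-trans (y₁<x₁ , x₂<y₂) (z₁<y₁ , y₂<z₂) = <-trans z₁<y₁ y₁<x₁ , <-trans x₂<y₂ y₂<z₂

chain⇒head-steps : ∀ {m M} → CondIII (m ∷ M) → All (StepIII m) M
chain⇒head-steps ch = AllPairs.head (Linked⇒AllPairs step-trans ch)

chain-∷ : ∀ {m M} → All (StepIII m) M → CondIII M → CondIII (m ∷ M)
chain-∷ []      _  = [-]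
chain-∷ (s ∷ _) ch = s ∷ ch

InGrid : ℕ → ℕ → ℕ → Row → Set
InGrid p B k (a , b) = a < p × B ≤ b × b < B + k

InGrid-mono : ∀ {p p′ B B′ k k′} → p ≤ p′ → B′ ≤ B → B + k ≤ B′ + k′ →
  ∀ {m} → InGrid p B k m → InGrid p′ B′ k′ m
InGrid-mono p≤p′ B′≤B top≤ (a<p , B≤b , b<top) =
  <-≤-trans a<p p≤p′ , ≤-trans B′≤B B≤b , <-≤-trans b<top top≤

-- gridChains p B k lists the chains with rows in [0 , p) × [B , B + k), and
-- headedChains p B k those in [0 , suc p) × [B , B + k) whose first row is (p , b).
mutual
  gridChains : ℕ → ℕ → ℕ → List (List Row)
  gridChains zero    B k = [] ∷ []
  gridChains (suc p) B k = gridChains p B k ++ headedChains p B k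

  headedChains : ℕ → ℕ → ℕ → List (List Row)
  headedChains p B zero    = []
  headedChains p B (suc k) =
    map ((p , B) ∷_) (gridChains p (suc B) k) ++ headedChains p (suc B) k

steps⇒inGrid : ∀ {p b q M} B k → B ≤ b → All (StepIII (p , b)) M →
  All (InGrid q B (suc k)) M → All (InGrid p (suc B) k) M
steps⇒inGrid B k B≤b steps grid = All.zipWith
  (λ ((a<p , b<b′) , (_ , _ , b′<top)) →
    a<p , ≤-<-trans B≤b b<b′ , ≤-trans b′<top (≤-reflexive (+-suc B k)))
  (steps , grid)

mutual
  gridChains-sound : ∀ p B k {M} → M ∈ gridChains p B k → CondIII M × All (InGrid p B k) M
  gridChains-sound zero    B k (here refl) = [] , []
  gridChains-sound (suc p) B k M∈ with ∈-++⁻ (gridChains p B k) M∈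
  ... | inj₁ M∈ᵍ = Product.map₂ (All.map (InGrid-mono (n≤1+n p) ≤-refl ≤-refl))
                                 (gridChains-sound p B k M∈ᵍ)
  ... | inj₂ M∈ʰ = headedChains-sound p B k M∈ʰ

  headedChains-sound : ∀ p B k {M} → M ∈ headedChains p B k →
    CondIII M × All (InGrid (suc p) B k) M
  headedChains-sound p B (suc k) M∈ with ∈-++⁻ (map ((p , B) ∷_) (gridChains p (suc B) k)) M∈
  ... | inj₂ M∈ʰ = Product.map₂ (All.map (InGrid-mono ≤-refl (n≤1+n B) top≤))
                                 (headedChains-sound p (suc B) k M∈ʰ)
    where top≤ = ≤-reflexive (sym (+-suc B k))
  ... | inj₁ M∈ᵐ with ∈-map⁻ ((p , B) ∷_) M∈ᵐ
  ...   | R , R∈ , refl =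
    chain-∷ (All.map (λ (a<p , B<b , _) → a<p , B<b) grid) chain ,
    (n<1+n p , ≤-refl , m<m+n B z<s) ∷ All.map (InGrid-mono (n≤1+n p) (n≤1+n B) top≤) grid
    where
    top≤ = ≤-reflexive (sym (+-suc B k))
    chain = proj₁ (gridChains-sound p (suc B) k R∈)
    grid  = proj₂ (gridChains-sound p (suc B) k R∈)

mutual
  gridChains-complete : ∀ p B k {M} → CondIII M → All (InGrid p B k) M → M ∈ gridChains p B k
  gridChains-complete zero    B k {[]}    _ _                 = here refl
  gridChains-complete zero    B k {_ ∷ _} _ ((() , _) ∷ _)
  gridChains-complete (suc p) B k {[]}    _ _                 = ∈-++⁺ˡ (gridChains-complete p B k [] [])
  gridChains-complete (suc p) B k {(a , b) ∷ M} ch (g@(a<1+p , rest) ∷ gs) with a ≟ p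
  ... | yes refl = ∈-++⁺ʳ (gridChains p B k) (headedChains-complete p B k ch (g ∷ gs))
  ... | no a≢p   = ∈-++⁺ˡ (gridChains-complete p B k ch ((a<p , rest) ∷ gs′))
    where
    a<p = ≤∧≢⇒< (≤-pred a<1+p) a≢p
    gs′ = All.zipWith (λ ((a′<a , _) , (_ , g′)) → <-trans a′<a a<p , g′) (chain⇒head-steps ch , gs)

  headedChains-complete : ∀ p B k {b M} → CondIII ((p , b) ∷ M) →
    All (InGrid (suc p) B k) ((p , b) ∷ M) → ((p , b) ∷ M) ∈ headedChains p B k
  headedChains-complete p B zero _ ((_ , B≤b , b<B+0) ∷ _) =
    ⊥-elim (≤⇒≯ B≤b (subst (_ <_) (+-identityʳ B) b<B+0))
  headedChains-complete p B (suc k) {b} ch ((_ , B≤b , b<top) ∷ gs) with b ≟ B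
  ... | yes refl = ∈-++⁺ˡ (∈-map⁺ ((p , B) ∷_)
                     (gridChains-complete p (suc B) k (Linked.tail ch) (steps⇒inGrid B k ≤-refl steps gs)))
    where steps = chain⇒head-steps ch
  ... | no b≢B = ∈-++⁺ʳ (map ((p , B) ∷_) (gridChains p (suc B) k))
                   (headedChains-complete p (suc B) k ch (head′ ∷ gs′))
    where
    B<b = ≤∧≢⇒< B≤b (b≢B ∘ sym)
    head′ = n<1+n p , B<b , ≤-trans b<top (≤-reflexive (+-suc B k))
    gs′ = All.map (InGrid-mono (n≤1+n p) ≤-refl ≤-refl) (steps⇒inGrid B k B≤b (chain⇒head-steps ch) gs)

headedChains-head : ∀ p B k {M} → M ∈ headedChains p B k → ∃₂ λ b R → B ≤ b × M ≡ (p , b) ∷ R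
headedChains-head p B (suc k) M∈ with ∈-++⁻ (map ((p , B) ∷_) (gridChains p (suc B) k)) M∈
... | inj₁ M∈ᵐ with ∈-map⁻ ((p , B) ∷_) M∈ᵐ
...   | R , _ , refl = B , R , ≤-refl , refl
headedChains-head p B (suc k) M∈ | inj₂ M∈ʰ with headedChains-head p (suc B) k M∈ʰ
... | b , R , B<b , refl = b , R , <⇒≤ B<b , refl

mutual
  gridChains-unique : ∀ p B k → Unique (gridChains p B k)
  gridChains-unique zero    B k = [] ∷ []
  gridChains-unique (suc p) B k =
    Unique.++⁺ (gridChains-unique p B k) (headedChains-unique p B k) disjoint
    where
    disjoint : Disjoint (gridChains p B k) (headedChains p B k)
    disjoint (M∈ᵍ , M∈ʰ) with headedChains-head p B k M∈ʰ
    ... | _ , _ , _ , refl with gridChains-sound p B k M∈ᵍ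
    ...   | _ , (p<p , _) ∷ _ = <-irrefl refl p<p

  headedChains-unique : ∀ p B k → Unique (headedChains p B k)
  headedChains-unique p B zero    = []
  headedChains-unique p B (suc k) =
    Unique.++⁺ (Unique.map⁺ ∷-injectiveʳ (gridChains-unique p (suc B) k))
               (headedChains-unique p (suc B) k) disjoint
    where
    disjoint : Disjoint (map ((p , B) ∷_) (gridChains p (suc B) k)) (headedChains p (suc B) k)
    disjoint (M∈ᵐ , M∈ʰ) with ∈-map⁻ ((p , B) ∷_) M∈ᵐ | headedChains-head p (suc B) k M∈ʰ
    ... | _ , _ , refl | _ , _ , B<B , refl = <-irrefl refl B<B

mutual
  length-gridChains : ∀ p B k → length (gridChains p B k) ≡ pascal p k
  length-gridChains zero    B k = refl
  length-gridChains (suc p) B k = begin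
    length (gridChains p B k ++ headedChains p B k)          ≡⟨ length-++ (gridChains p B k) ⟩
    length (gridChains p B k) + length (headedChains p B k)
      ≡⟨ cong (_+ length (headedChains p B k)) (length-gridChains p B k) ⟩
    pascal p k + length (headedChains p B k)                 ≡⟨ +-comm (pascal p k) _ ⟩
    length (headedChains p B k) + pascal p k                 ≡⟨ length-headedChains p B k ⟩
    pascal (suc p) k                                         ∎

  length-headedChains : ∀ p B k → length (headedChains p B k) + pascal p k ≡ pascal (suc p) k
  length-headedChains p B zero    = pascal-zeroʳ p
  length-headedChains p B (suc k) = begin
    length (map ((p , B) ∷_) chains ++ headed) + pascal p (suc k)
      ≡⟨ cong (_+ pascal p (suc k)) (length-++ (map ((p , B) ∷_) chains)) ⟩
    length (map ((p , B) ∷_) chains) + length headed + pascal p (suc k)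
      ≡⟨ cong (λ n → n + length headed + pascal p (suc k))
              (trans (length-map ((p , B) ∷_) chains) (length-gridChains p (suc B) k)) ⟩
    pascal p k + length headed + pascal p (suc k)
      ≡⟨ cong (_+ pascal p (suc k)) (+-comm (pascal p k) (length headed)) ⟩
    length headed + pascal p k + pascal p (suc k)
      ≡⟨ cong (_+ pascal p (suc k)) (length-headedChains p (suc B) k) ⟩
    pascal (suc p) k + pascal p (suc k)
      ≡⟨ +-comm (pascal (suc p) k) (pascal p (suc k)) ⟩
    pascal (suc p) (suc k) ∎
    where
    chains = gridChains p (suc B) k
    headed = headedChains p (suc B) k

-- Admissible shifts

_≼_ : Row → Row → Set
(x₁ , x₂) ≼ (y₁ , y₂) = x₁ ≤ y₁ × x₂ ≤ y₂

Uncovered : List Row → Row → Set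
Uncovered M x = All (λ m → ¬ x ≼ m) M

uncovered-intro : ∀ {M x y} → All (λ m → proj₁ m < x ⊎ proj₂ m < y) M → Uncovered M (x , y)
uncovered-intro = All.map λ where
  (inj₁ m₁<x) (x≤m₁ , _)   → <⇒≱ m₁<x x≤m₁
  (inj₂ m₂<y) (_   , y≤m₂) → <⇒≱ m₂<y y≤m₂

admissible⁺ : ∀ {n̄ M x} → x ≼ n̄ → Uncovered M x → Admissible n̄ M (toℤ² x)
admissible⁺ (x₁≤ , x₂≤) uncovered =
  (+≤+ z≤n , +≤+ z≤n) , (+≤+ x₁≤ , +≤+ x₂≤) ,
  All.map (λ ¬≼ (p , q) → ¬≼ (drop‿+≤+ p , drop‿+≤+ q)) uncovered

admissible⁻ : ∀ {n̄ M x} → Admissible n̄ M (toℤ² x) → x ≼ n̄ × Uncovered M x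
admissible⁻ (_ , (x₁≤ , x₂≤) , uncovered) =
  (drop‿+≤+ x₁≤ , drop‿+≤+ x₂≤) , All.map (λ ¬⪯ (p , q) → ¬⪯ (+≤+ p , +≤+ q)) uncovered

row⇒¬admissible : ∀ {n̄ M m} → m ∈ M → ¬ Admissible n̄ M (toℤ² m)
row⇒¬admissible m∈ adm = All.lookup (proj₂ (admissible⁻ adm)) m∈ (≤-refl , ≤-refl)

shiftL-suc : ∀ a b → shiftL (suc a , b) ≡ toℤ² (a , suc b)
shiftL-suc a b = cong (λ y → ℤ.+ a , ℤ.+ y) (+-comm b 1)

shiftR-suc : ∀ a b → shiftR (a , suc b) ≡ toℤ² (suc a , b)
shiftR-suc a b = cong (λ x → ℤ.+ x , ℤ.+ b) (+-comm a 1)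

shiftL-admissible⁻ : ∀ {n̄ M} m → Admissible n̄ M (shiftL m) →
  ∃₂ λ a b → m ≡ (suc a , b) × Admissible n̄ M (toℤ² (a , suc b))
shiftL-admissible⁻ (zero  , b) ((() , _) , _)
shiftL-admissible⁻ (suc a , b) adm = a , b , refl , subst (Admissible _ _) (shiftL-suc a b) adm

shiftR-admissible⁻ : ∀ {n̄ M} m → Admissible n̄ M (shiftR m) →
  ∃₂ λ a b → m ≡ (a , suc b) × Admissible n̄ M (toℤ² (suc a , b))
shiftR-admissible⁻ (a , zero)  ((_ , ()) , _)
shiftR-admissible⁻ (a , suc b) adm = a , b , refl , subst (Admissible _ _) (shiftR-suc a b) adm

shiftL-admissible⁺ : ∀ {n̄ M} a b → (a , suc b) ≼ n̄ → Uncovered M (a , suc b) →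
  Admissible n̄ M (shiftL (suc a , b))
shiftL-admissible⁺ a b ≼n̄ uncovered =
  subst (Admissible _ _) (sym (shiftL-suc a b)) (admissible⁺ ≼n̄ uncovered)

shiftR-admissible⁺ : ∀ {n̄ M} a b → (suc a , b) ≼ n̄ → Uncovered M (suc a , b) →
  Admissible n̄ M (shiftR (a , suc b))
shiftR-admissible⁺ a b ≼n̄ uncovered =
  subst (Admissible _ _) (sym (shiftR-suc a b)) (admissible⁺ ≼n̄ uncovered)

⪯? : (u v : ℤ.ℤ × ℤ.ℤ) → Dec (u ⪯ v)
⪯? (u₁ , u₂) (v₁ , v₂) = (u₁ ℤ.≤? v₁) ×-dec (u₂ ℤ.≤? v₂)

admissible? : ∀ n̄ M m′ → Dec (Admissible n̄ M m′)
admissible? n̄ M m′ =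
  ⪯? (ℤ.+ 0 , ℤ.+ 0) m′ ×-dec ⪯? m′ (toℤ² n̄) ×-dec All.all? (λ m → ¬? (⪯? m′ (toℤ² m))) M

condIV? : ∀ n̄ → Decidable (CondIV n̄)
condIV? n̄ M = Any.any? (λ m → admissible? n̄ M (shiftL m) ⊎-dec admissible? n̄ M (shiftR m)) M

-- Chains without (IV')

staircaseTail : ℕ → ℕ → ℕ → List Row
staircaseTail zero    b k       = []
staircaseTail (suc a) b zero    = []
staircaseTail (suc a) b (suc k) = (a , suc b) ∷ staircaseTail a (suc b) k

staircase : ℕ → ℕ → ℕ → List Row
staircase a b k = (a , b) ∷ staircaseTail a b k

staircase-chain : ∀ a b k → CondIII (staircase a b k)
staircase-chain zero    b k       = [-]
staircase-chain (suc a) b zero    = [-]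
staircase-chain (suc a) b (suc k) = (n<1+n a , n<1+n b) ∷ staircase-chain a (suc b) k

staircase-bounded : ∀ a b k → All (_≼ (a , b + k)) (staircase a b k)
staircase-bounded zero    b k       = (≤-refl , m≤m+n b k) ∷ []
staircase-bounded (suc a) b zero    = (≤-refl , m≤m+n b 0) ∷ []
staircase-bounded (suc a) b (suc k) = (≤-refl , m≤m+n b (suc k)) ∷
  All.map (λ (x≤a , y≤) → m≤n⇒m≤1+n x≤a , ≤-trans y≤ (≤-reflexive (sym (+-suc b k))))
          (staircase-bounded a (suc b) k)

staircase-inBox : ∀ {n1 n2} a b k → a ≤ n1 → b + k ≡ n2 → CondII (n1 , n2) (staircase a b k)
staircase-inBox a b k a≤n1 end =
  All.map (λ (x≤a , y≤) → ≤-trans x≤a a≤n1 , ≤-trans y≤ (≤-reflexive end)) (staircase-bounded a b k)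

staircase-left : ∀ a b k {x y} → (suc x , y) ∈ staircase a b k →
  y ≡ b + k ⊎ (x , suc y) ∈ staircase a b k
staircase-left zero    b k       (here ())
staircase-left (suc a) b zero    (here refl) = inj₁ (sym (+-identityʳ b))
staircase-left (suc a) b (suc k) (here refl) = inj₂ (there (here refl))
staircase-left (suc a) b (suc k) (there m∈) with staircase-left a (suc b) k m∈
... | inj₁ y≡ = inj₁ (trans y≡ (sym (+-suc b k)))
... | inj₂ n∈ = inj₂ (there n∈)

staircase-right : ∀ a b k {x y} → (x , suc y) ∈ staircase a b k →
  (x , suc y) ≡ (a , b) ⊎ (suc x , y) ∈ staircase a b k
staircase-right a       b k       (here e)   = inj₁ e
staircase-right (suc a) b (suc k) (there m∈) with staircase-right a (suc b) k m∈
... | inj₁ refl = inj₂ (here refl)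
... | inj₂ n∈   = inj₂ (there n∈)

-- Each shifted row is the next or previous row of the staircase, or lies outside the box.
staircase-¬condIV : ∀ {n1 n2} a b k → a ≡ n1 ⊎ b ≡ 0 → b + k ≡ n2 →
  ¬ CondIV (n1 , n2) (staircase a b k)
staircase-¬condIV a b k start end iv with find iv
... | m , m∈ , inj₁ admL with shiftL-admissible⁻ m admL
...   | x , y , refl , adm with staircase-left a b k m∈
...     | inj₁ refl = <-irrefl end (proj₂ (proj₁ (admissible⁻ adm)))
...     | inj₂ m′∈  = row⇒¬admissible m′∈ adm
staircase-¬condIV a b k start end iv | m , m∈ , inj₂ admR with shiftR-admissible⁻ m admR
...   | x , y , refl , adm with staircase-right a b k m∈
...     | inj₂ m′∈  = row⇒¬admissible m′∈ adm
...     | inj₁ refl with start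
...       | inj₁ refl = <-irrefl refl (proj₁ (proj₁ (admissible⁻ adm)))
...       | inj₂ ()

topStaircase : ℕ → ℕ → ℕ → List Row
topStaircase n1 n2 b = staircase n1 b (n2 ∸ b)

leftStaircase : ℕ → ℕ → List Row
leftStaircase n2 a = staircase a 0 n2

chainsWithoutIV : ℕ → ℕ → List (List Row)
chainsWithoutIV n1 n2 =
  [] ∷ (applyUpTo (topStaircase n1 n2) (suc n2) ++ applyUpTo (leftStaircase n2) n1)

chainsWithoutIV-sound : ∀ {n1 n2 M} → M ∈ chainsWithoutIV n1 n2 →
  CondII (n1 , n2) M × CondIII M × ¬ CondIV (n1 , n2) M
chainsWithoutIV-sound (here refl) = [] , [] , λ ()
chainsWithoutIV-sound {n1} {n2} (there M∈) with ∈-++⁻ (applyUpTo (topStaircase n1 n2) (suc n2)) M∈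
... | inj₁ M∈ᵗ with ∈-applyUpTo⁻ (topStaircase n1 n2) M∈ᵗ
...   | b , b<1+n2 , refl =
  staircase-inBox n1 b (n2 ∸ b) ≤-refl end , staircase-chain n1 b (n2 ∸ b) ,
  staircase-¬condIV n1 b (n2 ∸ b) (inj₁ refl) end
  where end = m+[n∸m]≡n (≤-pred b<1+n2)
chainsWithoutIV-sound {n1} {n2} (there M∈) | inj₂ M∈ˡ with ∈-applyUpTo⁻ (leftStaircase n2) M∈ˡ
...   | a , a<n1 , refl =
  staircase-inBox a 0 n2 (<⇒≤ a<n1) refl , staircase-chain a 0 n2 ,
  staircase-¬condIV a 0 n2 (inj₂ refl) refl

staircase-injective : ∀ {a b k a′ b′ k′} → staircase a b k ≡ staircase a′ b′ k′ →
  a ≡ a′ × b ≡ b′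
staircase-injective eq with refl ← ∷-injectiveˡ eq = refl , refl

chainsWithoutIV-unique : ∀ n1 n2 → Unique (chainsWithoutIV n1 n2)
chainsWithoutIV-unique n1 n2 =
  All.tabulate ([]≢ ∘ ∈-++⁻ (applyUpTo (topStaircase n1 n2) (suc n2))) ∷
  Unique.++⁺
    (Unique.applyUpTo⁺₁ (topStaircase n1 n2) (suc n2) (λ i<j _ → <⇒≢ i<j ∘ proj₂ ∘ staircase-injective))
    (Unique.applyUpTo⁺₁ (leftStaircase n2) n1 (λ i<j _ → <⇒≢ i<j ∘ proj₁ ∘ staircase-injective))
    disjoint
  where
  []≢ : ∀ {M} → M ∈ applyUpTo (topStaircase n1 n2) (suc n2) ⊎ M ∈ applyUpTo (leftStaircase n2) n1 →
        [] ≢ M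
  []≢ (inj₁ M∈) refl with ∈-applyUpTo⁻ (topStaircase n1 n2) M∈
  ... | _ , _ , ()
  []≢ (inj₂ M∈) refl with ∈-applyUpTo⁻ (leftStaircase n2) M∈
  ... | _ , _ , ()
  disjoint : Disjoint (applyUpTo (topStaircase n1 n2) (suc n2)) (applyUpTo (leftStaircase n2) n1)
  disjoint (M∈ᵗ , M∈ˡ) with ∈-applyUpTo⁻ (topStaircase n1 n2) M∈ᵗ | ∈-applyUpTo⁻ (leftStaircase n2) M∈ˡ
  ... | _ , _ , refl | _ , a<n1 , eq = <-irrefl (sym (proj₁ (staircase-injective eq))) a<n1

length-chainsWithoutIV : ∀ n1 n2 → length (chainsWithoutIV n1 n2) ≡ 2 + n2 + n1
length-chainsWithoutIV n1 n2 = cong suc (begin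
  length (applyUpTo (topStaircase n1 n2) (suc n2) ++ applyUpTo (leftStaircase n2) n1)
    ≡⟨ length-++ (applyUpTo (topStaircase n1 n2) (suc n2)) ⟩
  length (applyUpTo (topStaircase n1 n2) (suc n2)) + length (applyUpTo (leftStaircase n2) n1)
    ≡⟨ cong₂ _+_ (length-applyUpTo (topStaircase n1 n2) (suc n2))
                 (length-applyUpTo (leftStaircase n2) n1) ⟩
  suc n2 + n1 ∎)

headShiftL-admissible : ∀ {n1 n2} P a b M → suc a ≤ n1 → suc b ≤ n2 →
  All (λ m → proj₂ m < b) P → All (λ m → proj₁ m < a) M →
  Admissible (n1 , n2) (P ++ (suc a , b) ∷ M) (shiftL (suc a , b))
headShiftL-admissible P a b M a<n1 b<n2 below left =
  shiftL-admissible⁺ a b (<⇒≤ a<n1 , b<n2)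
    (uncovered-intro (All.++⁺ (All.map (inj₂ ∘ m<n⇒m<1+n) below) (inj₂ ≤-refl ∷ All.map inj₁ left)))

secondShiftR-admissible : ∀ {n1 n2} P a b y M → suc a ≤ n1 → suc y ≤ n2 → b < y →
  All (λ m → proj₂ m < b) P → All (λ m → proj₁ m < a) M →
  Admissible (n1 , n2) (P ++ (suc a , b) ∷ (a , suc y) ∷ M) (shiftR (a , suc y))
secondShiftR-admissible P a b y M a<n1 y<n2 b<y below left =
  shiftR-admissible⁺ a y (a<n1 , <⇒≤ y<n2)
    (uncovered-intro (All.++⁺ (All.map (inj₂ ∘ λ m₂<b → <-trans m₂<b b<y) below)
      (inj₂ b<y ∷ inj₁ ≤-refl ∷ All.map (inj₁ ∘ m<n⇒m<1+n) left)))

¬condIV-head : ∀ {n1 n2 a b M} → CondII (n1 , n2) ((a , b) ∷ M) → CondIII ((a , b) ∷ M) →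
  ¬ CondIV (n1 , n2) ((a , b) ∷ M) → a < n1 → b ≡ 0
¬condIV-head {b = zero} _ _ _ _ = refl
¬condIV-head {a = a} {suc b} {M} ((_ , b<n2) ∷ _) ch ¬iv a<n1 =
  ⊥-elim (¬iv (here (inj₂ (shiftR-admissible⁺ a b (a<n1 , <⇒≤ b<n2) uncovered))))
  where
  uncovered : Uncovered ((a , suc b) ∷ M) (suc a , b)
  uncovered = uncovered-intro
    (inj₁ ≤-refl ∷ All.map (λ (a′<a , _) → inj₁ (m<n⇒m<1+n a′<a)) (chain⇒head-steps ch))

-- P is the prefix of rows already passed.
¬condIV⇒staircaseTail : ∀ {n1 n2} P a b M k → b + k ≡ n2 → All (λ m → proj₂ m < b) P →
  CondII (n1 , n2) ((a , b) ∷ M) → CondIII ((a , b) ∷ M) →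
  ¬ CondIV (n1 , n2) (P ++ (a , b) ∷ M) → M ≡ staircaseTail a b k
¬condIV⇒staircaseTail P zero    b []      k    _   _ _ _ _ = refl
¬condIV⇒staircaseTail P zero    b (_ ∷ _) k    _   _ _ ((() , _) ∷ _) _
¬condIV⇒staircaseTail P (suc a) b []      zero _   _ _ _ _ = refl
¬condIV⇒staircaseTail P (suc a) b (m ∷ _) zero end _ (_ ∷ (_ , m₂≤n2) ∷ _) ((_ , b<m₂) ∷ _) _ =
  ⊥-elim (<⇒≱ b<m₂ (subst (proj₂ m ≤_) (trans (sym end) (+-identityʳ b)) m₂≤n2))
¬condIV⇒staircaseTail P (suc a) b [] (suc k) end below ((a<n1 , _) ∷ []) _ ¬iv =
  ⊥-elim (¬iv (Any.++⁺ʳ P (here (inj₁ (headShiftL-admissible P a b [] a<n1 b<n2 below [])))))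
  where b<n2 = subst (suc b ≤_) end (m<m+n b z<s)
¬condIV⇒staircaseTail {n1} {n2} P (suc a) b ((a₂ , b₂) ∷ M) (suc k) end below
  ((a<n1 , _) ∷ box) ch@((a₂<1+a , b<b₂) ∷ ch′) ¬iv with a₂ ≟ a
... | no a₂≢a =
  ⊥-elim (¬iv (Any.++⁺ʳ P (here (inj₁ (headShiftL-admissible P a b _ a<n1 b<n2 below left)))))
  where
  b<n2 = subst (suc b ≤_) end (m<m+n b z<s)
  a₂<a = ≤∧≢⇒< (≤-pred a₂<1+a) a₂≢a
  left = a₂<a ∷ All.map (λ (a′<a₂ , _) → <-trans a′<a₂ a₂<a) (chain⇒head-steps ch′)
... | yes refl with b₂ ≟ suc b
...   | yes refl = cong ((a , suc b) ∷_)
  (¬condIV⇒staircaseTail (P ++ (suc a , b) ∷ []) a (suc b) M k (trans (sym (+-suc b k)) end)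
     (All.++⁺ (All.map m<n⇒m<1+n below) (n<1+n b ∷ [])) box ch′
     (¬iv ∘ subst (CondIV (n1 , n2)) (++-assoc P ((suc a , b) ∷ []) ((a , suc b) ∷ M))))
...   | no b₂≢1+b =
  ⊥-elim (¬iv (Any.++⁺ʳ P (there (here (inj₂ (shiftR-at b₂ b<b₂ b₂≢1+b (proj₂ (All.head box))))))))
  where
  shiftR-at : ∀ b₂ → b < b₂ → b₂ ≢ suc b → b₂ ≤ n2 →
    Admissible (n1 , n2) (P ++ (suc a , b) ∷ (a , b₂) ∷ M) (shiftR (a , b₂))
  shiftR-at (suc y) (s≤s b≤y) b₂≢1+b y<n2 =
    secondShiftR-admissible P a b y M a<n1 y<n2 (≤∧≢⇒< b≤y (b₂≢1+b ∘ cong suc ∘ sym)) below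
      (All.map proj₁ (chain⇒head-steps ch′))

chainsWithoutIV-complete : ∀ {n1 n2 M} → CondII (n1 , n2) M → CondIII M → ¬ CondIV (n1 , n2) M →
  M ∈ chainsWithoutIV n1 n2
chainsWithoutIV-complete {M = []} _ _ _ = here refl
chainsWithoutIV-complete {n1} {n2} {(a , b) ∷ M} box@((a≤n1 , b≤n2) ∷ _) ch ¬iv with a ≟ n1
... | yes refl with ¬condIV⇒staircaseTail [] a b M (n2 ∸ b) (m+[n∸m]≡n b≤n2) [] box ch ¬iv
...   | refl = there (∈-++⁺ˡ (∈-applyUpTo⁺ (topStaircase a n2) (s≤s b≤n2)))
chainsWithoutIV-complete {n1} {n2} {(a , b) ∷ M} box@((a≤n1 , b≤n2) ∷ _) ch ¬iv | no a≢n1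
  with a<n1 ← ≤∧≢⇒< a≤n1 a≢n1
  with refl ← ¬condIV-head box ch ¬iv a<n1
  with refl ← ¬condIV⇒staircaseTail [] a 0 M n2 refl [] box ch ¬iv =
  there (∈-++⁺ʳ (applyUpTo (topStaircase n1 n2) (suc n2)) (∈-applyUpTo⁺ (leftStaircase n2) a<n1))

-- Counting the valid pairs

boxChains : ℕ → ℕ → List (List Row)
boxChains n1 n2 = gridChains (suc n1) 0 (suc n2)

boxChains-sound : ∀ {n1 n2 M} → M ∈ boxChains n1 n2 → CondII (n1 , n2) M × CondIII M
boxChains-sound M∈ with ch , grid ← gridChains-sound _ 0 _ M∈ =
  All.map (λ (a<1+n1 , _ , b<1+n2) → ≤-pred a<1+n1 , ≤-pred b<1+n2) grid , ch

boxChains-complete : ∀ {n1 n2 M} → CondII (n1 , n2) M → CondIII M → M ∈ boxChains n1 n2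
boxChains-complete box ch =
  gridChains-complete _ 0 _ ch (All.map (λ (a≤n1 , b≤n2) → s≤s a≤n1 , z≤n , s≤s b≤n2) box)

length-boxChains-¬condIV : ∀ n1 n2 →
  length (filter (¬? ∘ condIV? (n1 , n2)) (boxChains n1 n2)) ≡ 2 + n2 + n1
length-boxChains-¬condIV n1 n2 = trans
  (unique∧set⇒length≡ (Unique.filter⁺ (¬? ∘ condIV? (n1 , n2)) (gridChains-unique (suc n1) 0 (suc n2)))
                      (chainsWithoutIV-unique n1 n2) (mk⇔ to from))
  (length-chainsWithoutIV n1 n2)
  where
  to : ∀ {M} → M ∈ filter (¬? ∘ condIV? (n1 , n2)) (boxChains n1 n2) → M ∈ chainsWithoutIV n1 n2
  to M∈ with M∈box , ¬iv ← ∈-filter⁻ (¬? ∘ condIV? (n1 , n2)) M∈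
        with box , ch ← boxChains-sound M∈box = chainsWithoutIV-complete box ch ¬iv
  from : ∀ {M} → M ∈ chainsWithoutIV n1 n2 → M ∈ filter (¬? ∘ condIV? (n1 , n2)) (boxChains n1 n2)
  from M∈ with box , ch , ¬iv ← chainsWithoutIV-sound M∈ =
    ∈-filter⁺ (¬? ∘ condIV? (n1 , n2)) (boxChains-complete box ch) ¬iv

validPairsAt : ℕ → ℕ → List (Row × List Row)
validPairsAt n1 n2 = map ((n1 , n2) ,_) (filter (condIV? (n1 , n2)) (boxChains n1 n2))

condIV⇒nonEmpty : ∀ {n̄ M} → CondIV n̄ M → NonEmpty M
condIV⇒nonEmpty {M = _ ∷ _} _ = tt

validPairsAt-sound : ∀ {n n1 n2 x} → 1 ≤ n1 → 1 ≤ n2 → n1 + n2 ≡ n → x ∈ validPairsAt n1 n2 → Valid n x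
validPairsAt-sound {n1 = n1} {n2} 1≤n1 1≤n2 size x∈
  with M , M∈ , refl ← ∈-map⁻ ((n1 , n2) ,_) x∈
  with M∈box , iv ← ∈-filter⁻ (condIV? (n1 , n2)) M∈
  with box , ch ← boxChains-sound M∈box =
  1≤n1 , 1≤n2 , size , condIV⇒nonEmpty iv , box , ch , iv

validPairsAt-complete : ∀ {n1 n2 M} → CondII (n1 , n2) M → CondIII M → CondIV (n1 , n2) M →
  ((n1 , n2) , M) ∈ validPairsAt n1 n2
validPairsAt-complete {n1} {n2} box ch iv =
  ∈-map⁺ ((n1 , n2) ,_) (∈-filter⁺ (condIV? (n1 , n2)) (boxChains-complete box ch) iv)

validPairsAt-unique : ∀ n1 n2 → Unique (validPairsAt n1 n2)
validPairsAt-unique n1 n2 =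
  Unique.map⁺ (cong proj₂) (Unique.filter⁺ (condIV? (n1 , n2)) (gridChains-unique (suc n1) 0 (suc n2)))

validPairsAt-dimensions : ∀ {n1 n2 x} → x ∈ validPairsAt n1 n2 → proj₁ x ≡ (n1 , n2)
validPairsAt-dimensions {n1} {n2} x∈ with _ , _ , refl ← ∈-map⁻ ((n1 , n2) ,_) x∈ = refl

length-validPairsAt : ∀ n1 n2 → length (validPairsAt n1 n2) + (2 + n2 + n1) ≡ pascal (suc n1) (suc n2)
length-validPairsAt n1 n2 = begin
  length (validPairsAt n1 n2) + (2 + n2 + n1)
    ≡⟨ cong (_+ (2 + n2 + n1)) (length-map ((n1 , n2) ,_) (filter iv? chains)) ⟩
  length (filter iv? chains) + (2 + n2 + n1)
    ≡⟨ cong (length (filter iv? chains) +_) (length-boxChains-¬condIV n1 n2) ⟨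
  length (filter iv? chains) + length (filter (¬? ∘ iv?) chains)
    ≡⟨ length-filter+length-filter-¬ iv? chains ⟩
  length chains
    ≡⟨ length-gridChains (suc n1) 0 (suc n2) ⟩
  pascal (suc n1) (suc n2) ∎
  where
  iv? = condIV? (n1 , n2)
  chains = boxChains n1 n2

validPairsFrom : ℕ → ℕ → List (Row × List Row)
validPairsFrom i zero    = validPairsAt (suc i) 1
validPairsFrom i (suc k) = validPairsAt (suc i) (suc (suc k)) ++ validPairsFrom (suc i) k

validPairsFrom-first : ∀ i k {x} → x ∈ validPairsFrom i k → i < proj₁ (proj₁ x)
validPairsFrom-first i zero    x∈ = ≤-reflexive (sym (cong proj₁ (validPairsAt-dimensions x∈)))
validPairsFrom-first i (suc k) x∈ with ∈-++⁻ (validPairsAt (suc i) (suc (suc k))) x∈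
... | inj₁ x∈ᵃ = ≤-reflexive (sym (cong proj₁ (validPairsAt-dimensions x∈ᵃ)))
... | inj₂ x∈ᶠ = <⇒≤ (validPairsFrom-first (suc i) k x∈ᶠ)

validPairsFrom-sound : ∀ i k {x} → x ∈ validPairsFrom i k → Valid (suc i + suc k) x
validPairsFrom-sound i zero    x∈ = validPairsAt-sound (s≤s z≤n) (s≤s z≤n) refl x∈
validPairsFrom-sound i (suc k) {x} x∈ with ∈-++⁻ (validPairsAt (suc i) (suc (suc k))) x∈
... | inj₁ x∈ᵃ = validPairsAt-sound (s≤s z≤n) (s≤s z≤n) refl x∈ᵃ
... | inj₂ x∈ᶠ = subst (λ n → Valid n x) (cong suc (sym (+-suc i (suc k))))
                       (validPairsFrom-sound (suc i) k x∈ᶠ)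

validPairsFrom-complete : ∀ i k {n1 n2 M} → i < n1 → 1 ≤ n2 → n1 + n2 ≡ suc i + suc k →
  CondII (n1 , n2) M → CondIII M → CondIV (n1 , n2) M → ((n1 , n2) , M) ∈ validPairsFrom i k
validPairsFrom-complete i k {n1} {n2} i<n1 1≤n2 size box ch iv with n1 ≟ suc i
... | yes refl with refl ← +-cancelˡ-≡ (suc i) n2 (suc k) size with k
...   | zero  = validPairsAt-complete box ch iv
...   | suc _ = ∈-++⁺ˡ (validPairsAt-complete box ch iv)
validPairsFrom-complete i zero    i<n1 1≤n2 size _ _ _ | no n1≢1+i =
  ⊥-elim (<-irrefl (sym size) (+-mono-≤ (≤∧≢⇒< i<n1 (n1≢1+i ∘ sym)) 1≤n2))
validPairsFrom-complete i (suc k) i<n1 1≤n2 size box ch iv | no n1≢1+i =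
  ∈-++⁺ʳ (validPairsAt (suc i) (suc (suc k)))
    (validPairsFrom-complete (suc i) k (≤∧≢⇒< i<n1 (n1≢1+i ∘ sym)) 1≤n2
      (trans size (cong suc (+-suc i (suc k)))) box ch iv)

validPairsFrom-unique : ∀ i k → Unique (validPairsFrom i k)
validPairsFrom-unique i zero    = validPairsAt-unique (suc i) 1
validPairsFrom-unique i (suc k) =
  Unique.++⁺ (validPairsAt-unique (suc i) (suc (suc k))) (validPairsFrom-unique (suc i) k) disjoint
  where
  disjoint : Disjoint (validPairsAt (suc i) (suc (suc k))) (validPairsFrom (suc i) k)
  disjoint (x∈ᵃ , x∈ᶠ) =
    <-irrefl (sym (cong proj₁ (validPairsAt-dimensions x∈ᵃ))) (validPairsFrom-first (suc i) k x∈ᶠ)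

length-validPairsFrom : ∀ i k →
  length (validPairsFrom i k) + suc ((2 + k) * (4 + i + k)) ≡ antidiagonal (2 + i) (2 + k)
length-validPairsFrom i zero = begin
  length (validPairsAt (suc i) 1) + suc (2 * (4 + i + 0))
    ≡⟨ regroup (length (validPairsAt (suc i) 1)) i ⟩
  (length (validPairsAt (suc i) 1) + (2 + 1 + suc i)) + ((4 + i) + 1)
    ≡⟨ cong₂ _+_ (length-validPairsAt (suc i) 1) (cong (_+ 1) (sym (pascal-oneʳ (3 + i)))) ⟩
  antidiagonal (2 + i) 2 ∎
  where
  regroup : ∀ ℓ i → ℓ + suc (2 * (4 + i + 0)) ≡ (ℓ + (2 + 1 + suc i)) + ((4 + i) + 1)
  regroup = solve-∀
length-validPairsFrom i (suc k) = begin
  length (first ++ rest) + suc ((3 + k) * (4 + i + suc k))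
    ≡⟨ cong (_+ suc ((3 + k) * (4 + i + suc k))) (length-++ first) ⟩
  length first + length rest + suc ((3 + k) * (4 + i + suc k))
    ≡⟨ regroup (length first) (length rest) i k ⟩
  (length first + (2 + suc (suc k) + suc i)) + (length rest + suc ((2 + k) * (4 + suc i + k)))
    ≡⟨ cong₂ _+_ (length-validPairsAt (suc i) (suc (suc k))) (length-validPairsFrom (suc i) k) ⟩
  antidiagonal (2 + i) (3 + k) ∎
  where
  first = validPairsAt (suc i) (suc (suc k))
  rest = validPairsFrom (suc i) k
  regroup : ∀ ℓ ℓ′ i k → ℓ + ℓ′ + suc ((3 + k) * (4 + i + suc k))
                       ≡ (ℓ + (2 + suc (suc k) + suc i)) + (ℓ′ + suc ((2 + k) * (4 + suc i + k)))
  regroup = solve-∀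

length-validPairsFrom-zero : ∀ m →
  length (validPairsFrom 0 m) + ((2 + m) ^ 2 + 3 * (2 + m) + 4) ≡ 2 ^ (2 + m + 2)
length-validPairsFrom-zero m = begin
  ℓ + ((2 + m) ^ 2 + 3 * (2 + m) + 4)
    ≡⟨ regroup ℓ m ⟩
  1 + ((4 + m) + (ℓ + suc ((2 + m) * (4 + 0 + m))))
    ≡⟨ cong (λ t → 1 + ((4 + m) + t)) (length-validPairsFrom 0 m) ⟩
  1 + ((4 + m) + antidiagonal 2 (2 + m))
    ≡⟨ cong (λ t → 1 + (t + antidiagonal 2 (2 + m))) (pascal-oneˡ (3 + m)) ⟨
  antidiagonal 0 (4 + m)
    ≡⟨ antidiagonal-zero (4 + m) ⟩
  2 ^ (4 + m)
    ≡⟨ cong (λ t → 2 ^ (2 + t)) (+-comm 2 m) ⟩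
  2 ^ (2 + m + 2) ∎
  where
  ℓ = length (validPairsFrom 0 m)
  regroup : ∀ ℓ m → ℓ + ((2 + m) * ((2 + m) * 1) + 3 * (2 + m) + 4)
                  ≡ 1 + ((4 + m) + (ℓ + suc ((2 + m) * (4 + 0 + m))))
  regroup = solve-∀

mainTheorem6 : (n : ℕ) → 2 ≤ n →
    Σ (List (Row × List Row)) λ L →
      Unique L × (∀ x → (x ∈ L) ⇔ Valid n x)
      × (length L + (n ^ 2 + 3 * n + 4) ≡ 2 ^ (n + 2))
mainTheorem6 (suc (suc m)) (s≤s (s≤s z≤n)) =
  validPairsFrom 0 m , validPairsFrom-unique 0 m ,
  (λ x → mk⇔ (validPairsFrom-sound 0 m) (complete x)) , length-validPairsFrom-zero m
  where
  complete : ∀ x → Valid (2 + m) x → x ∈ validPairsFrom 0 m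
  complete ((n1 , n2) , M) (1≤n1 , 1≤n2 , size , _ , box , ch , iv) =
    validPairsFrom-complete 0 m 1≤n1 1≤n2 size box ch iv
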